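{- Let $m\ge2$, $\lambda=(n_1,\dots,n_m)\times[k_1,\dots,k_m]$, and put $K_j=k_1+\cdots+k_j$. Let $\mathcal C(\lambda)=(K_m,K_{m-1},\dots,K_1)\times[n_m,n_{m-1}-n_m,\dots,n_1-n_2]$ denote the conjugate. (i) If $n_2+n_m>n_1$, then \[\mathcal C(\tilde T_0(\lambda))=(2k_1+k_2+\cdots+k_m,K_m,K_{m-1},\dots,K_2)\times[n_1-n_2,\ n_2+n_m-n_1,\ n_{m-1}-n_m,\ n_{m-2}-n_{m-1},\dots,n_2-n_3]\] and $\tilde T_0(\mathcal C(\tilde T_0(\lambda)))=\mathcal C(\lambda)$. (ii) If $n_2+n_m<n_1$, then \[\mathcal C(\tilde T_1(\lambda))=(2k_1+k_2+\cdots+k_m,K_{m-1},K_{m-2},\dots,K_1)\times[n_m,\ n_{m-1}-n_m,\dots,n_2-n_3,\ n_1-n_m-n_2]\] and $\tilde T_1(\mathcal C(\tilde T_1(\lambda)))=\mathcal C(\lambda)$. That is, both diagrams formed by $\tilde T_i$ and conjugation commute.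
   Context: $(n_1,\dots,n_m)\times[k_1,\dots,k_m]$ denotes the partition with $k_i$ parts $n_i$; its conjugate partition (flipped Young diagram) is $(k_1+\cdots+k_m,k_1+\cdots+k_{m-1},\dots,k_1)\times[n_m,n_{m-1}-n_m,\dots,n_1-n_2]$. The extended slow-Triangle maps are $\tilde T_0((n_1,\dots,n_m)\times[k_1,\dots,k_m])=(n_2,\dots,n_m,n_1-n_2)\times[k_1+k_2,k_3,\dots,k_m,k_1]$ (used when $n_2+n_m>n_1$) and $\tilde T_1((n_1,\dots,n_m)\times[k_1,\dots,k_m])=(n_1-n_m,n_2,\dots,n_m)\times[k_1,\dots,k_{m-1},k_1+k_m]$ (used when $n_2+n_m<n_1$); in the claim they are applied as these formulas. -}

module Defs where

open import Data.Nat using (ℕ; zero; suc; _+_; _∸_; _<_; _≤_)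
open import Data.Vec using (Vec; []; _∷_; head; tail; last; init; reverse; _∷ʳ_)
open import Data.Vec.Relation.Unary.All using (All)
open import Data.Product using (_×_; _,_)

-- A multiplicity-form partition (n₁,…,nₘ)×[k₁,…,kₘ] is a pair of vectors
-- (parts , multiplicities) of the same length m.
Shape : ℕ → Set
Shape m = Vec ℕ m × Vec ℕ m

data Decr : {n : ℕ} → Vec ℕ n → Set where
  nil  : Decr []
  one  : (x : ℕ) → Decr (x ∷ [])
  cons : {n x y : ℕ} {r : Vec ℕ n} → y < x → Decr (y ∷ r) → Decr (x ∷ y ∷ r)

record Valid {j : ℕ} (λ' : Shape (2 + j)) : Set where
  field
    decreasing : Decr (Data.Product.proj₁ λ')
    lastPos    : 1 ≤ last (Data.Product.proj₁ λ')
    multsPos   : All (1 ≤_) (Data.Product.proj₂ λ')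

psumsFrom : {n : ℕ} → ℕ → Vec ℕ n → Vec ℕ n
psumsFrom acc [] = []
psumsFrom acc (k ∷ ks) = (acc + k) ∷ psumsFrom (acc + k) ks

psums : {n : ℕ} → Vec ℕ n → Vec ℕ n
psums = psumsFrom 0

diffs : {n : ℕ} → Vec ℕ n → Vec ℕ n
diffs [] = []
diffs (x ∷ []) = x ∷ []
diffs (x ∷ y ∷ r) = (x ∸ y) ∷ diffs (y ∷ r)

conj : {m : ℕ} → Shape m → Shape m
conj (ns , ks) = reverse (psums ks) , reverse (diffs ns)

T0 : {j : ℕ} → Shape (2 + j) → Shape (2 + j)
T0 (n₁ ∷ n₂ ∷ ns , k₁ ∷ k₂ ∷ ks) = (n₂ ∷ ns) ∷ʳ (n₁ ∸ n₂) , ((k₁ + k₂) ∷ ks) ∷ʳ k₁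

T1 : {j : ℕ} → Shape (2 + j) → Shape (2 + j)
T1 (n₁ ∷ ns , ks) = (n₁ ∸ last ns) ∷ ns , init ks ∷ʳ (head ks + last ks)

-- T̃₀ appends k₁ to the multiplicities, which
-- appends k₁ + Kₘ to the partial sums, and appends n₁ − n₂ to the parts, which splits
-- the last difference nₘ into (nₘ − (n₁ − n₂)) and n₁ − n₂; a second T̃₀ subtracts
-- the new first part back off and re-merges these two differences into nₘ.
-- T̃₁ is dual: it acts at the other end of both vectors. The conditions on n₂ + nₘ
-- are exactly what keeps all truncated subtractions honest.
module Submission where

open import Defs
open import Data.Nat using (ℕ; suc; _+_; _∸_; _<_; _>_; _≤_)
open import Data.Nat.Properties
  using (<⇒≤; +-comm; ∸-+-assoc; m+[n∸m]≡n; [m+n]∸[m+o]≡n∸o; m≤n+o⇒m∸n≤o; m+n∸n≡m; m+n∸m≡n; m+n≤o⇒m≤o∸n; +-commutativeSemigroup)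
open import Algebra.Properties.CommutativeSemigroup +-commutativeSemigroup using (x∙yz≈y∙xz)
open import Data.Vec using (Vec; []; _∷_; head; tail; last; init; reverse; _∷ʳ_; initLast)
open import Data.Vec.Properties using (reverse-∷; reverse-involutive; reverse-reverse; last-reverse; init-∷ʳ; last-∷ʳ)
open import Data.Product using (_×_; _,_)
open import Relation.Binary.PropositionalEquality using (_≡_; refl; sym; trans; cong; cong₂; subst)
open Relation.Binary.PropositionalEquality.≡-Reasoning

private
  variable
    A : Set
    n : ℕ

reverse-∷ʳ : (x : A) (xs : Vec A n) → reverse (xs ∷ʳ x) ≡ x ∷ reverse xs
reverse-∷ʳ x xs = reverse-reverse (begin
  reverse (x ∷ reverse xs)  ≡⟨ reverse-∷ x (reverse xs) ⟩
  reverse (reverse xs) ∷ʳ x ≡⟨ cong (_∷ʳ x) (reverse-involutive xs) ⟩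
  xs ∷ʳ x                   ∎)

head-reverse : (xs : Vec A (suc n)) → head (reverse xs) ≡ last xs
head-reverse xs = trans (sym (last-reverse (reverse xs))) (cong last (reverse-involutive xs))

head-∷ʳ : (xs : Vec A (suc n)) (x : A) → head (xs ∷ʳ x) ≡ head xs
head-∷ʳ (y ∷ xs) x = refl

reverse-init∷ʳlast : (xs : Vec A (suc n)) → reverse xs ≡ last xs ∷ reverse (init xs)
reverse-init∷ʳlast xs with initLast xs
... | ys , y , refl = reverse-∷ʳ y ys

psumsFrom-∷ʳ : (a : ℕ) (ks : Vec ℕ n) (k : ℕ) →
  psumsFrom a (ks ∷ʳ k) ≡ psumsFrom a ks ∷ʳ (last (a ∷ psumsFrom a ks) + k)
psumsFrom-∷ʳ a []       k = refl
psumsFrom-∷ʳ a (k′ ∷ ks) k = cong (a + k′ ∷_) (psumsFrom-∷ʳ (a + k′) ks k)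

psums-T0 : (k₁ k₂ : ℕ) (ks : Vec ℕ n) →
  psums (((k₁ + k₂) ∷ ks) ∷ʳ k₁) ≡ tail (psums (k₁ ∷ k₂ ∷ ks)) ∷ʳ (k₁ + last (psums (k₁ ∷ k₂ ∷ ks)))
psums-T0 k₁ k₂ ks = cong (k₁ + k₂ ∷_) (begin
  psumsFrom (k₁ + k₂) (ks ∷ʳ k₁)
    ≡⟨ psumsFrom-∷ʳ (k₁ + k₂) ks k₁ ⟩
  psumsFrom (k₁ + k₂) ks ∷ʳ (last (k₁ + k₂ ∷ psumsFrom (k₁ + k₂) ks) + k₁)
    ≡⟨ cong (psumsFrom (k₁ + k₂) ks ∷ʳ_) (+-comm _ k₁) ⟩
  psumsFrom (k₁ + k₂) ks ∷ʳ (k₁ + last (k₁ + k₂ ∷ psumsFrom (k₁ + k₂) ks)) ∎)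

psums-T1 : (k : ℕ) (ks : Vec ℕ (suc n)) →
  psums (init ks ∷ʳ (k + last ks)) ≡ init (psums ks) ∷ʳ (k + last (psums ks))
psums-T1 k ks with initLast ks
... | ks′ , k′ , refl = begin
  psums (ks′ ∷ʳ (k + k′))
    ≡⟨ psumsFrom-∷ʳ 0 ks′ (k + k′) ⟩
  psums ks′ ∷ʳ (K + (k + k′))
    ≡⟨ cong (psums ks′ ∷ʳ_) (x∙yz≈y∙xz K k k′) ⟩
  psums ks′ ∷ʳ (k + (K + k′))
    ≡⟨ cong₂ (λ us u → us ∷ʳ (k + u)) (sym (init-∷ʳ (K + k′) (psums ks′))) (sym (last-∷ʳ (K + k′) (psums ks′))) ⟩
  init (psums ks′ ∷ʳ (K + k′)) ∷ʳ (k + last (psums ks′ ∷ʳ (K + k′)))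
    ≡⟨ cong (λ ps → init ps ∷ʳ (k + last ps)) (sym (psumsFrom-∷ʳ 0 ks′ k′)) ⟩
  init (psums (ks′ ∷ʳ k′)) ∷ʳ (k + last (psums (ks′ ∷ʳ k′))) ∎
  where
  K : ℕ
  K = last (0 ∷ psums ks′)

diffs-∷ʳ : (x : ℕ) (xs : Vec ℕ n) (y : ℕ) →
  diffs ((x ∷ xs) ∷ʳ y) ≡ (init (diffs (x ∷ xs)) ∷ʳ (last (x ∷ xs) ∸ y)) ∷ʳ y
diffs-∷ʳ x []       y = refl
diffs-∷ʳ x (x′ ∷ xs) y = cong (x ∸ x′ ∷_) (diffs-∷ʳ x′ xs y)

last-diffs : (xs : Vec ℕ (suc n)) → last (diffs xs) ≡ last xs
last-diffs (x ∷ [])      = refl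
last-diffs (x ∷ x′ ∷ xs) = last-diffs (x′ ∷ xs)

m∸[n∸o]≡o+m∸n : ∀ m {n o} → o ≤ n → m ∸ (n ∸ o) ≡ o + m ∸ n
m∸[n∸o]≡o+m∸n m {n} {o} o≤n = begin
  m ∸ (n ∸ o)               ≡⟨ sym ([m+n]∸[m+o]≡n∸o o m (n ∸ o)) ⟩
  o + m ∸ (o + (n ∸ o))     ≡⟨ cong (o + m ∸_) (m+[n∸m]≡n o≤n) ⟩
  o + m ∸ n                 ∎

m+[n∸m∸o]≡n∸o : ∀ m {n o} → o + m ≤ n → m + (n ∸ m ∸ o) ≡ n ∸ o
m+[n∸m∸o]≡n∸o m {n} {o} o+m≤n = begin
  m + (n ∸ m ∸ o)   ≡⟨ cong (m +_) (∸-+-assoc n m o) ⟩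
  m + (n ∸ (m + o)) ≡⟨ cong (λ p → m + (n ∸ p)) (+-comm m o) ⟩
  m + (n ∸ (o + m)) ≡⟨ cong (m +_) (sym (∸-+-assoc n o m)) ⟩
  m + (n ∸ o ∸ m)   ≡⟨ m+[n∸m]≡n (m+n≤o⇒m≤o∸n m (subst (_≤ n) (+-comm o m) o+m≤n)) ⟩
  n ∸ o             ∎

T0-∷ : (a : ℕ) (as : Vec ℕ (suc n)) (b₁ b₂ : ℕ) (bs : Vec ℕ n) →
  T0 (a ∷ as , b₁ ∷ b₂ ∷ bs) ≡ (as ∷ʳ (a ∸ head as) , ((b₁ + b₂) ∷ bs) ∷ʳ b₁)
T0-∷ a (a′ ∷ as) b₁ b₂ bs = refl

module _ (n₁ n₂ : ℕ) (ns : Vec ℕ n) (k₁ k₂ : ℕ) (ks : Vec ℕ n) where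

  private
    λ′ : Shape (2 + n)
    λ′ = n₁ ∷ n₂ ∷ ns , k₁ ∷ k₂ ∷ ks

    nₘ : ℕ
    nₘ = last (n₂ ∷ ns)

    P : Vec ℕ (2 + n)
    P = psums (k₁ ∷ k₂ ∷ ks)

    V : Vec ℕ (suc n)
    V = diffs (n₂ ∷ ns)

  conj-T0 : n₂ ≤ n₁ →
    conj (T0 λ′) ≡ ((k₁ + last P) ∷ reverse (tail P) , (n₁ ∸ n₂) ∷ (n₂ + nₘ ∸ n₁) ∷ reverse (init V))
  conj-T0 n₂≤n₁ = cong₂ _,_ (begin
    reverse (psums (((k₁ + k₂) ∷ ks) ∷ʳ k₁)) ≡⟨ cong reverse (psums-T0 k₁ k₂ ks) ⟩
    reverse (tail P ∷ʳ (k₁ + last P))        ≡⟨ reverse-∷ʳ (k₁ + last P) (tail P) ⟩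
    (k₁ + last P) ∷ reverse (tail P)         ∎) (begin
    reverse (diffs ((n₂ ∷ ns) ∷ʳ d))                     ≡⟨ cong reverse (diffs-∷ʳ n₂ ns d) ⟩
    reverse ((init V ∷ʳ (nₘ ∸ d)) ∷ʳ d)                  ≡⟨ reverse-∷ʳ d (init V ∷ʳ (nₘ ∸ d)) ⟩
    d ∷ reverse (init V ∷ʳ (nₘ ∸ d))                     ≡⟨ cong (d ∷_) (reverse-∷ʳ (nₘ ∸ d) (init V)) ⟩
    d ∷ (nₘ ∸ d) ∷ reverse (init V)                      ≡⟨ cong (λ e → d ∷ e ∷ reverse (init V)) (m∸[n∸o]≡o+m∸n nₘ n₂≤n₁) ⟩
    d ∷ (n₂ + nₘ ∸ n₁) ∷ reverse (init V)                ∎)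
    where
    d : ℕ
    d = n₁ ∸ n₂

  T0-conj-T0 : n₂ ≤ n₁ → n₁ ≤ n₂ + nₘ → T0 (conj (T0 λ′)) ≡ conj λ′
  T0-conj-T0 n₂≤n₁ n₁≤n₂+nₘ = begin
    T0 (conj (T0 λ′))
      ≡⟨ cong T0 (conj-T0 n₂≤n₁) ⟩
    T0 ((k₁ + last P) ∷ reverse (tail P) , d ∷ (n₂ + nₘ ∸ n₁) ∷ reverse (init V))
      ≡⟨ T0-∷ (k₁ + last P) (reverse (tail P)) d (n₂ + nₘ ∸ n₁) (reverse (init V)) ⟩
    (reverse (tail P) ∷ʳ (k₁ + last P ∸ head (reverse (tail P))) , ((d + (n₂ + nₘ ∸ n₁)) ∷ reverse (init V)) ∷ʳ d)
      ≡⟨ cong₂ _,_ parts multiplicities ⟩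
    conj λ′ ∎
    where
    d : ℕ
    d = n₁ ∸ n₂

    parts : reverse (tail P) ∷ʳ (k₁ + last P ∸ head (reverse (tail P))) ≡ reverse P
    parts = begin
      reverse (tail P) ∷ʳ (k₁ + last P ∸ head (reverse (tail P))) ≡⟨ cong (λ h → reverse (tail P) ∷ʳ (k₁ + last P ∸ h)) (head-reverse (tail P)) ⟩
      reverse (tail P) ∷ʳ (k₁ + last P ∸ last P)                  ≡⟨ cong (reverse (tail P) ∷ʳ_) (m+n∸n≡m k₁ (last P)) ⟩
      reverse (tail P) ∷ʳ k₁                                      ≡⟨ sym (reverse-∷ k₁ (tail P)) ⟩
      reverse P                                                   ∎

    d+[n₂+nₘ∸n₁]≡nₘ : d + (n₂ + nₘ ∸ n₁) ≡ nₘ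
    d+[n₂+nₘ∸n₁]≡nₘ = begin
      d + (n₂ + nₘ ∸ n₁) ≡⟨ cong (d +_) (sym (m∸[n∸o]≡o+m∸n nₘ n₂≤n₁)) ⟩
      d + (nₘ ∸ d)       ≡⟨ m+[n∸m]≡n (m≤n+o⇒m∸n≤o n₁ n₂ n₁≤n₂+nₘ) ⟩
      nₘ                 ∎

    multiplicities : ((d + (n₂ + nₘ ∸ n₁)) ∷ reverse (init V)) ∷ʳ d ≡ reverse (d ∷ V)
    multiplicities = begin
      ((d + (n₂ + nₘ ∸ n₁)) ∷ reverse (init V)) ∷ʳ d ≡⟨ cong (λ x → (x ∷ reverse (init V)) ∷ʳ d) (trans d+[n₂+nₘ∸n₁]≡nₘ (sym (last-diffs (n₂ ∷ ns)))) ⟩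
      (last V ∷ reverse (init V)) ∷ʳ d               ≡⟨ cong (_∷ʳ d) (sym (reverse-init∷ʳlast V)) ⟩
      reverse V ∷ʳ d                                 ≡⟨ sym (reverse-∷ d V) ⟩
      reverse (d ∷ V)                                ∎

  conj-T1 : conj (T1 λ′) ≡ ((k₁ + last P) ∷ reverse (init P) , reverse V ∷ʳ (n₁ ∸ nₘ ∸ n₂))
  conj-T1 = cong₂ _,_ (begin
    reverse (psums (init (k₁ ∷ k₂ ∷ ks) ∷ʳ (k₁ + last (k₁ ∷ k₂ ∷ ks)))) ≡⟨ cong reverse (psums-T1 k₁ (k₁ ∷ k₂ ∷ ks)) ⟩
    reverse (init P ∷ʳ (k₁ + last P))                                   ≡⟨ reverse-∷ʳ (k₁ + last P) (init P) ⟩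
    (k₁ + last P) ∷ reverse (init P)                                    ∎)
    (reverse-∷ (n₁ ∸ nₘ ∸ n₂) V)

  T1-conj-T1 : n₂ + nₘ ≤ n₁ → T1 (conj (T1 λ′)) ≡ conj λ′
  T1-conj-T1 n₂+nₘ≤n₁ = begin
    T1 (conj (T1 λ′))                                                ≡⟨ cong T1 conj-T1 ⟩
    T1 ((k₁ + last P) ∷ reverse (init P) , reverse V ∷ʳ d)           ≡⟨ cong₂ _,_ parts multiplicities ⟩
    conj λ′                                                          ∎
    where
    d : ℕ
    d = n₁ ∸ nₘ ∸ n₂

    parts : (k₁ + last P ∸ last (reverse (init P))) ∷ reverse (init P) ≡ reverse P
    parts = begin
      (k₁ + last P ∸ last (reverse (init P))) ∷ reverse (init P) ≡⟨ cong (λ l → (k₁ + last P ∸ l) ∷ reverse (init P)) (last-reverse (init P)) ⟩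
      (k₁ + last P ∸ k₁) ∷ reverse (init P)                      ≡⟨ cong (_∷ reverse (init P)) (m+n∸m≡n k₁ (last P)) ⟩
      last P ∷ reverse (init P)                                  ≡⟨ sym (reverse-init∷ʳlast P) ⟩
      reverse P                                                  ∎

    multiplicities : init (reverse V ∷ʳ d) ∷ʳ (head (reverse V ∷ʳ d) + last (reverse V ∷ʳ d)) ≡ reverse ((n₁ ∸ n₂) ∷ V)
    multiplicities = begin
      init (reverse V ∷ʳ d) ∷ʳ (head (reverse V ∷ʳ d) + last (reverse V ∷ʳ d))
        ≡⟨ cong₂ (λ us u → us ∷ʳ (u + last (reverse V ∷ʳ d))) (init-∷ʳ d (reverse V)) (head-∷ʳ (reverse V) d) ⟩
      reverse V ∷ʳ (head (reverse V) + last (reverse V ∷ʳ d))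
        ≡⟨ cong₂ (λ h l → reverse V ∷ʳ (h + l)) (trans (head-reverse V) (last-diffs (n₂ ∷ ns))) (last-∷ʳ d (reverse V)) ⟩
      reverse V ∷ʳ (nₘ + d)
        ≡⟨ cong (reverse V ∷ʳ_) (m+[n∸m∸o]≡n∸o nₘ n₂+nₘ≤n₁) ⟩
      reverse V ∷ʳ (n₁ ∸ n₂)
        ≡⟨ sym (reverse-∷ (n₁ ∸ n₂) V) ⟩
      reverse ((n₁ ∸ n₂) ∷ V) ∎

proposition5p4 : (j : ℕ) (ns ks : Vec ℕ (2 + j)) → Valid (ns , ks) →
    ((head (tail ns) + last ns > head ns) →
      (conj (T0 (ns , ks))
         ≡ ((head ks + last (psums ks)) ∷ reverse (tail (psums ks))
           , (head ns ∸ head (tail ns)) ∷ (head (tail ns) + last ns ∸ head ns)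
               ∷ reverse (init (tail (diffs ns)))))
      × (T0 (conj (T0 (ns , ks))) ≡ conj (ns , ks)))
    × ((head (tail ns) + last ns < head ns) →
      (conj (T1 (ns , ks))
         ≡ ((head ks + last (psums ks)) ∷ reverse (init (psums ks))
           , reverse (tail (diffs ns)) ∷ʳ (head ns ∸ last ns ∸ head (tail ns))))
      × (T1 (conj (T1 (ns , ks))) ≡ conj (ns , ks)))
proposition5p4 j (n₁ ∷ n₂ ∷ ns) (k₁ ∷ k₂ ∷ ks) valid =
  (λ n₁<n₂+nₘ → conj-T0 n₁ n₂ ns k₁ k₂ ks n₂≤n₁ , T0-conj-T0 n₁ n₂ ns k₁ k₂ ks n₂≤n₁ (<⇒≤ n₁<n₂+nₘ)) ,
  (λ n₂+nₘ<n₁ → conj-T1 n₁ n₂ ns k₁ k₂ ks , T1-conj-T1 n₁ n₂ ns k₁ k₂ ks (<⇒≤ n₂+nₘ<n₁))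
  where
  n₂≤n₁ : n₂ ≤ n₁
  n₂≤n₁ with Valid.decreasing valid
  ... | cons n₂<n₁ _ = <⇒≤ n₂<n₁
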